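{- Let $(P,\leq)$ be a poset and let $\mathcal{C}$ be a class of pairs $(D,x)$ with $D\subseteq P$ directed and $x\in P$ such that $$\{(\{y\},x): x,y\in P,\ x\leq y\}\subseteq\mathcal{C}\subseteq\{(D,x): D \text{ a directed subset of } P,\ x\in D^{\delta}\}.$$ Let $\mathcal{C}(P)$ be the topology on $P$ determined by $\mathcal{C}$, i.e. $U\in\mathcal{C}(P)$ iff for every $(D,x)\in\mathcal{C}$ with $x\in U$, $D$ is eventually in $U$. Then: (1) for every $F\subseteq P$, the closure of $F$ in $(P,\mathcal{C}(P))$ equals $F^{*}$; (2) the specialization order of $(P,\mathcal{C}(P))$ equals $\leq$; (3) $(P,\mathcal{C}(P))$ is a directed space; (4) $F\subseteq P$ is closed in $(P,\mathcal{C}(P))$ iff for every $(D,x)\in\mathcal{C}$ with $D\subseteq F$ we have $x\in F$.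
   Context: For a subset $A$ of a poset $P$, $ub(A)$ is the set of upper bounds of $A$ and $A^{\delta}=\{x\in P: x\leq y \text{ for all } y\in ub(A)\}$. A directed set $D$ is regarded as the monotone net $(d)_{d\in D}$; "eventually in $U$" has the usual net meaning. For $F\subseteq P$ and ordinals $\alpha$ define $F^0=F$, $F^{\alpha}=\{x\in P: \exists D\subseteq\bigcup_{\beta<\alpha}F^{\beta} \text{ with } (D,x)\in\mathcal{C}\}$ for $\alpha>0$, and $F^{*}=\bigcup_{\alpha}F^{\alpha}$. Specialization order of a space: $x\sqsubseteq y$ iff $x\in\overline{\{y\}}$. A directed subset $D$ of a space converges to $x$ if it meets every open neighbourhood of $x$. A $T_0$ space $X$ is a directed space if every subset $U$ such that "for all directed $D$ and $x\in U$ with $D$ converging to $x$, $D\cap U\neq\emptyset$" is open. -}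

module Defs where

open import Level using (Level; _⊔_; Lift; lift) renaming (suc to lsuc)
open import Data.Product using (Σ; _×_; _,_; ∃)
open import Data.Sum using (_⊎_)
open import Data.Unit using (⊤)
open import Data.Empty using (⊥)
open import Relation.Nullary using (¬_)
open import Relation.Unary using (Pred; _⊆_; _∈_; ∁)
open import Relation.Binary.PropositionalEquality using (_≡_)
open import Function.Bundles using (_⇔_)

module OrderNotions {ℓ : Level} {P : Set ℓ} (_≤_ : P → P → Set ℓ) where

  Directed : Pred P ℓ → Set ℓ
  Directed D = Σ P (λ d → D d)
             × (∀ a b → D a → D b → Σ P (λ c → D c × a ≤ c × b ≤ c))

  ub : Pred P ℓ → Pred P ℓ
  ub A y = ∀ a → A a → a ≤ y

  δ : Pred P ℓ → Pred P ℓ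
  δ A x = ∀ y → ub A y → x ≤ y

  EventuallyIn : Pred P ℓ → Pred P ℓ → Set ℓ
  EventuallyIn D U = Σ P (λ d₀ → D d₀ × (∀ d → D d → d₀ ≤ d → U d))

module TopNotions {ℓ ℓ' : Level} {P : Set ℓ} (Open : Pred P ℓ → Set ℓ') where

  Closed : Pred P ℓ → Set ℓ'
  Closed F = Open (∁ F)

  closure : Pred P ℓ → Pred P (lsuc ℓ ⊔ ℓ')
  closure F x = ∀ G → Closed G → F ⊆ G → G x

  _⊑_ : P → P → Set (lsuc ℓ ⊔ ℓ')
  x ⊑ y = closure (λ z → z ≡ y) x

  T₀ : Set (ℓ ⊔ lsuc ℓ ⊔ ℓ')
  T₀ = ∀ x y → (∀ U → Open U → (U x ⇔ U y)) → x ≡ y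

  DirectedSp : Pred P ℓ → Set (lsuc ℓ ⊔ ℓ')
  DirectedSp D = Σ P (λ d → D d)
               × (∀ a b → D a → D b → Σ P (λ c → D c × a ⊑ c × b ⊑ c))

  ConvergesTo : Pred P ℓ → P → Set (lsuc ℓ ⊔ ℓ')
  ConvergesTo D x = ∀ V → Open V → V x → Σ P (λ d → D d × V d)

  DirectedSpace : Set (lsuc ℓ ⊔ ℓ')
  DirectedSpace =
    T₀ × (∀ U → (∀ D x → DirectedSp D → U x → ConvergesTo D x
                        → Σ P (λ d → D d × U d))
              → Open U)

data Ord (ℓ : Level) : Set (lsuc ℓ) where
  ozero : Ord ℓ
  osuc  : Ord ℓ → Ord ℓ
  olim  : (I : Set ℓ) → (I → Ord ℓ) → Ord ℓ

module Theory {ℓ : Level} {P : Set ℓ} (_≤_ : P → P → Set ℓ)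
              (C : Pred P ℓ → P → Set ℓ) where

  open OrderNotions _≤_ public

  IsOpen : Pred P ℓ → Set (lsuc ℓ)
  IsOpen U = ∀ D x → C D x → U x → EventuallyIn D U

  open TopNotions IsOpen public

  -- F^α and ⋃_{β<α} F^β, by recursion on α
  mutual
    stage : Pred P ℓ → Ord ℓ → Pred P (lsuc ℓ)
    stage F ozero        x = Lift (lsuc ℓ) (F x)
    stage F (osuc α)     x = Σ (Pred P ℓ) (λ D → D ⊆ below F (osuc α) × C D x)
    stage F (olim I f)   x = Σ (Pred P ℓ) (λ D → D ⊆ below F (olim I f) × C D x)

    below : Pred P ℓ → Ord ℓ → Pred P (lsuc ℓ)
    below F ozero      x = Lift (lsuc ℓ) ⊥
    below F (osuc α)   x = stage F α x ⊎ below F α x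
    below F (olim I f) x = Σ I (λ i → stage F (f i) x ⊎ below F (f i) x)

  star : Pred P ℓ → Pred P (lsuc ℓ)
  star F x = Σ (Ord ℓ) (λ α → stage F α x)

module Submission where

-- A set is closed in C(P) exactly when it is closed under C-limits: a point
-- outside F has a neighbourhood ∁ F, so every D ⊆ F would eventually leave F;
-- conversely, C-closed sets are down-sets (singletons are in C), so once some
-- d₀ ∈ D lies outside F, all of D above d₀ does. The transfinite iteration F*
-- is the least C-closed superset of F, hence the closure. Principal down-sets
-- are closed because C only has limits in D^δ, which yields the specialization
-- order. Finally, if the net D of a pair (D , x) ∈ C is not eventually in U,
-- its part outside U is cofinal, hence directed and convergent to x.

open import Defs
open import Level using (Level; _⊔_; Lift; lift; lower) renaming (suc to lsuc)
open import Data.Product using (_×_; Σ; _,_; proj₁; proj₂)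
open import Data.Sum using (inj₁; inj₂)
open import Relation.Nullary using (¬_)
open import Relation.Nullary.Decidable using (True; toWitness; fromWitness; map′)
open import Relation.Unary using (Pred; _⊆_; ∁)
open import Relation.Binary.Core using (Rel)
open import Relation.Binary.Definitions using (Reflexive; Transitive; Antisymmetric)
open import Relation.Binary.PropositionalEquality using (_≡_; refl)
open import Relation.Binary.Structures using (IsPartialOrder)
open import Function.Bundles using (_⇔_; mk⇔; Equivalence)
open import Function.Properties.Equivalence using () renaming (sym to ⇔-sym)
open import Axiom.ExcludedMiddle using (ExcludedMiddle)
open import Axiom.DoubleNegationElimination using (em⇒dne)

module _ {ℓ : Level} {P : Set ℓ} (_≤_ : Rel P ℓ) (C : Pred P ℓ → P → Set ℓ) where

  open Theory _≤_ C

  C-Closed : ∀ {a} → Pred P a → Set (lsuc ℓ ⊔ a)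
  C-Closed F = ∀ D x → C D x → D ⊆ F → F x

  module _ {a} {F : Pred P ℓ} {G : Pred P a} (G-closed : C-Closed G) (F⊆G : F ⊆ G) where

    mutual
      stage⊆ : ∀ α → stage F α ⊆ G
      stage⊆ ozero      (lift Fx)       = F⊆G Fx
      stage⊆ (osuc α)   (D , D⊆ , CDx) = G-closed D _ CDx (λ Dd → below⊆ (osuc α) (D⊆ Dd))
      stage⊆ (olim I f) (D , D⊆ , CDx) = G-closed D _ CDx (λ Dd → below⊆ (olim I f) (D⊆ Dd))

      below⊆ : ∀ α → below F α ⊆ G
      below⊆ ozero      (lift ())
      below⊆ (osuc α)   (inj₁ s)     = stage⊆ α s
      below⊆ (osuc α)   (inj₂ b)     = below⊆ α b
      below⊆ (olim I f) (i , inj₁ s) = stage⊆ (f i) s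
      below⊆ (olim I f) (i , inj₂ b) = below⊆ (f i) b

    star⊆ : star F ⊆ G
    star⊆ (α , s) = stage⊆ α s

  -- The limit ordinal is indexed by the members of D, bounding their stages.
  star-C-Closed : ∀ F → C-Closed (star F)
  star-C-Closed F D x CDx D⊆ =
    olim (Σ P D) (λ (d , Dd) → proj₁ (D⊆ Dd))
    , D , (λ {d} Dd → (d , Dd) , inj₁ (proj₂ (D⊆ Dd))) , CDx

  ↓-C-Closed : (∀ D x → C D x → δ D x) → ∀ y → C-Closed (_≤ y)
  ↓-C-Closed C⇒δ y D x CDx D⊆↓y = C⇒δ D x CDx y (λ _ Dd → D⊆↓y Dd)

  module _ (singleton-C : ∀ x y → x ≤ y → C (λ z → z ≡ y) x) where

    C-Closed⇒lower : ∀ {F : Pred P ℓ} {x y} → C-Closed F → x ≤ y → F y → F x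
    C-Closed⇒lower {y = y} F-closed x≤y Fy =
      F-closed _ _ (singleton-C _ y x≤y) (λ { refl → Fy })

  Directed⇒DirectedSp : (∀ {a b} → a ≤ b → a ⊑ b) → ∀ {D} → Directed D → DirectedSp D
  Directed⇒DirectedSp ≤⇒⊑ (inhabited , bound) =
    inhabited , λ a b Da Db →
      let c , Dc , a≤c , b≤c = bound a b Da Db in c , Dc , ≤⇒⊑ a≤c , ≤⇒⊑ b≤c

  module Classical (em : ExcludedMiddle (lsuc ℓ)) (≤-refl : Reflexive _≤_)
                   (singleton-C : ∀ x y → x ≤ y → C (λ z → z ≡ y) x) where

    dne : {A : Set ℓ} → ¬ ¬ A → A
    dne = em⇒dne (map′ lower lift em)

    Closed⇒C-Closed : ∀ {F} → Closed F → C-Closed F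
    Closed⇒C-Closed F-closed D x CDx D⊆F = dne λ ¬Fx →
      let d₀ , Dd₀ , eventually-∁F = F-closed D x CDx ¬Fx
      in eventually-∁F d₀ Dd₀ ≤-refl (D⊆F Dd₀)

    C-Closed⇒Closed : ∀ {F} → C-Closed F → Closed F
    C-Closed⇒Closed {F} F-closed D x CDx ¬Fx =
      d₀ , Dd₀ , λ d _ d₀≤d Fd → ¬Fd₀ (C-Closed⇒lower singleton-C F-closed d₀≤d Fd)
      where
      outside : Σ P (λ d → D d × ¬ F d)
      outside = dne λ D⊆F → ¬Fx (F-closed D x CDx λ {d} Dd → dne λ ¬Fd → D⊆F (d , Dd , ¬Fd))
      d₀ = proj₁ outside
      Dd₀ = proj₁ (proj₂ outside)
      ¬Fd₀ = proj₂ (proj₂ outside)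

    Closed⇔C-Closed : ∀ F → Closed F ⇔ C-Closed F
    Closed⇔C-Closed F = mk⇔ Closed⇒C-Closed C-Closed⇒Closed

    -- star F lives in Set (lsuc ℓ); excluded middle lets it be resized to a Pred P ℓ.
    star↓ : Pred P ℓ → Pred P ℓ
    star↓ F x = Lift ℓ (True (em {star F x}))

    closure⇔star : ∀ F x → closure F x ⇔ star F x
    closure⇔star F x = mk⇔ closure⊆star star⊆closure
      where
      star↓-closed : Closed (star↓ F)
      star↓-closed = C-Closed⇒Closed λ D y CDy D⊆ →
        lift (fromWitness (star-C-Closed F D y CDy (λ Dd → toWitness (lower (D⊆ Dd)))))

      F⊆star↓ : F ⊆ star↓ F
      F⊆star↓ {y} Fy = lift (fromWitness {a? = em {star F y}} (ozero , lift Fy))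

      closure⊆star : closure F x → star F x
      closure⊆star x∈cl = toWitness (lower (x∈cl (star↓ F) star↓-closed F⊆star↓))

      star⊆closure : star F x → closure F x
      star⊆closure x∈F* G G-closed F⊆G = star⊆ (Closed⇒C-Closed G-closed) F⊆G x∈F*

    module _ (C⇒δ : ∀ D x → C D x → δ D x) where

      ↓-Closed : ∀ y → Closed (_≤ y)
      ↓-Closed y = C-Closed⇒Closed (↓-C-Closed C⇒δ y)

      ⊑⇔≤ : ∀ x y → x ⊑ y ⇔ x ≤ y
      ⊑⇔≤ x y = mk⇔
        (λ x⊑y → x⊑y (_≤ y) (↓-Closed y) λ { refl → ≤-refl })
        (λ x≤y G G-closed y∈G → C-Closed⇒lower singleton-C (Closed⇒C-Closed G-closed) x≤y (y∈G refl))

      -- ∁ ↓y is an open set containing x unless x ≤ y.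
      same-neighbourhoods⇒≤ : ∀ {x y} → (∀ U → IsOpen U → (U x ⇔ U y)) → x ≤ y
      same-neighbourhoods⇒≤ {y = y} same = dne λ x≰y →
        Equivalence.to (same (∁ (_≤ y)) (↓-Closed y)) x≰y ≤-refl

      C-T₀ : Antisymmetric _≡_ _≤_ → T₀
      C-T₀ antisym x y same =
        antisym (same-neighbourhoods⇒≤ same)
                (same-neighbourhoods⇒≤ λ U U-open → ⇔-sym (same U U-open))

    module _ (≤-trans : Transitive _≤_) where

      module _ {D U} (not-eventually : ¬ EventuallyIn D U) where

        cofinal-outside : ∀ {d₀} → D d₀ → Σ P (λ d → D d × d₀ ≤ d × ¬ U d)
        cofinal-outside {d₀} Dd₀ = dne λ none →
          not-eventually (d₀ , Dd₀ , λ d Dd d₀≤d → dne λ ¬Ud → none (d , Dd , d₀≤d , ¬Ud))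

        Directed-outside : Directed D → Directed (λ d → D d × ¬ U d)
        Directed-outside ((e , De) , bound) =
          (let d , Dd , _ , ¬Ud = cofinal-outside De in d , Dd , ¬Ud)
          , λ a b (Da , _) (Db , _) →
              let c , Dc , a≤c , b≤c = bound a b Da Db
                  d , Dd , c≤d , ¬Ud = cofinal-outside Dc
              in d , (Dd , ¬Ud) , ≤-trans a≤c c≤d , ≤-trans b≤c c≤d

        converges-outside : ∀ {x} → C D x → ConvergesTo (λ d → D d × ¬ U d) x
        converges-outside CDx V V-open Vx =
          let d₀ , Dd₀ , eventually-V = V-open D _ CDx Vx
              d , Dd , d₀≤d , ¬Ud = cofinal-outside Dd₀
          in d , (Dd , ¬Ud) , eventually-V d Dd d₀≤d

      directed-inaccessible⇒open : (∀ {a b} → a ≤ b → a ⊑ b) → (∀ D x → C D x → Directed D) →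
        ∀ U → (∀ D x → DirectedSp D → U x → ConvergesTo D x → Σ P (λ d → D d × U d)) →
        IsOpen U
      directed-inaccessible⇒open ≤⇒⊑ C⇒Directed U U-inaccessible D x CDx Ux = dne λ not-eventually →
        let _ , (_ , ¬Ud) , Ud =
              U-inaccessible _ x
                (Directed⇒DirectedSp ≤⇒⊑ (Directed-outside not-eventually (C⇒Directed D x CDx)))
                Ux (converges-outside not-eventually CDx)
        in ¬Ud Ud

proposition2p9 : {ℓ : Level} → ExcludedMiddle (lsuc ℓ) →
    (P : Set ℓ) (_≤_ : P → P → Set ℓ) → IsPartialOrder _≡_ _≤_ →
    (C : Pred P ℓ → P → Set ℓ) →
    (∀ x y → x ≤ y → C (λ z → z ≡ y) x) →
    (∀ D x → C D x → OrderNotions.Directed _≤_ D × OrderNotions.δ _≤_ D x) →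
    let open Theory _≤_ C in
      (∀ F x → closure F x ⇔ star F x)
      × (∀ x y → x ⊑ y ⇔ x ≤ y)
      × DirectedSpace
      × (∀ F → Closed F ⇔ (∀ D x → C D x → D ⊆ F → F x))
proposition2p9 em P _≤_ po C singleton-C C-directed-δ =
  closure⇔star
  , ⊑⇔≤ C⇒δ
  , (C-T₀ C⇒δ antisym
    , directed-inaccessible⇒open trans (λ {a} {b} → Equivalence.from (⊑⇔≤ C⇒δ a b)) C⇒Directed)
  , Closed⇔C-Closed
  where
  open IsPartialOrder po using (antisym; trans) renaming (refl to ≤-refl)
  open Classical _≤_ C em ≤-refl singleton-C
  open OrderNotions _≤_ using (Directed; δ)

  C⇒Directed : ∀ D x → C D x → Directed D
  C⇒Directed D x CDx = proj₁ (C-directed-δ D x CDx)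

  C⇒δ : ∀ D x → C D x → δ D x
  C⇒δ D x CDx = proj₂ (C-directed-δ D x CDx)
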